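{- Every color graph is bipartite.
   Context: Let $V=\mathbb{Z}_2\times\mathbb{Z}_2$ be the Klein four-group with elements $0,1,2,3$ ($1+2+3=0$, $x+x=0$). Let $n\geq 3$ and let $P$ be a convex $n$-gon whose vertices are colored by elements of $V$ so that adjacent polygon vertices have different colors. A triangulation of $P$ (using only the vertices of $P$) is compatible with the coloring if every diagonal of the triangulation joins two differently colored vertices. The color graph of this coloring has as vertices the compatible triangulations, two being adjacent iff they differ by a single diagonal flip. (Equivalently, color graphs are defined via color vectors of nonzero elements of $V$ assigned to the leaves of rooted planar binary trees, vertices being trees whose leaf coloring extends to a proper edge $3$-coloring with colors summing to $0$ at each internal vertex, and edges being rotations.) -}

module Defs where

open import Data.Nat using (ℕ; zero; suc; _+_; _≤_; _<_; _∸_)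
open import Data.Fin using (Fin; toℕ)
open import Data.Bool using (Bool; true; false)
open import Data.Product using (_×_; Σ; ∃; ∃-syntax)
open import Data.Sum using (_⊎_)
open import Relation.Nullary using (¬_)
open import Relation.Binary.PropositionalEquality using (_≡_; _≢_)

-- Klein four-group V = Z2 × Z2, elements 0,1,2,3 with 1+2+3 = 0, x+x = 0.
-- (Only the underlying set matters for the statement; the group law is recorded
-- for completeness.)
V : Set
V = Fin 4

-- Vertices of the convex n-gon are Fin n, in cyclic order 0,1,...,n-1.
-- A coloring is proper if cyclically adjacent vertices get different colors.
ProperColoring : (n : ℕ) → (Fin n → V) → Set
ProperColoring n col =
  (∀ (i j : Fin n) → toℕ j ≡ suc (toℕ i) → col i ≢ col j) ×
  (∀ (i j : Fin n) → toℕ i ≡ 0 → toℕ j ≡ n ∸ 1 → col i ≢ col j)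

-- (i , j) with i < j is a diagonal of the convex n-gon: i and j are not
-- adjacent, i.e. i + 2 ≤ j and j + 2 ≤ n + i (the latter excludes (0, n-1)).
IsDiag : (n : ℕ) → Fin n → Fin n → Set
IsDiag n i j = (suc (suc (toℕ i)) ≤ toℕ j) × (suc (suc (toℕ j)) ≤ n + toℕ i)

Crosses : {n : ℕ} → Fin n → Fin n → Fin n → Fin n → Set
Crosses i j k l =
  ((toℕ i < toℕ k) × (toℕ k < toℕ j) × (toℕ j < toℕ l))  ⊎
  ((toℕ k < toℕ i) × (toℕ i < toℕ l) × (toℕ l < toℕ j))

DiagSet : ℕ → Set
DiagSet n = Fin n → Fin n → Bool

IsTriangulation : (n : ℕ) → DiagSet n → Set
IsTriangulation n D =
  (∀ i j → D i j ≡ true → IsDiag n i j) ×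
  (∀ i j k l → D i j ≡ true → D k l ≡ true → ¬ Crosses i j k l) ×
  (∀ i j → IsDiag n i j → D i j ≡ false →
     ∃[ k ] ∃[ l ] (D k l ≡ true × Crosses i j k l))

Compatible : (n : ℕ) → (Fin n → V) → DiagSet n → Set
Compatible n col D = ∀ i j → D i j ≡ true → col i ≢ col j

IsColorGraphVertex : (n : ℕ) → (Fin n → V) → DiagSet n → Set
IsColorGraphVertex n col D = IsTriangulation n D × Compatible n col D

Flip : (n : ℕ) → DiagSet n → DiagSet n → Set
Flip n D D' =
  ∃[ i ] ∃[ j ] ∃[ k ] ∃[ l ]
    ( D i j ≡ true × D' i j ≡ false × D k l ≡ false × D' k l ≡ true ×
      (∀ a b → ¬ ((a ≡ i) × (b ≡ j)) → ¬ ((a ≡ k) × (b ≡ l)) → D a b ≡ D' a b))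

ColorGraphBipartite : (n : ℕ) → (Fin n → V) → Set
ColorGraphBipartite n col =
  Σ (DiagSet n → Bool) λ f →
    ∀ D D' → IsColorGraphVertex n col D → IsColorGraphVertex n col D' →
      Flip n D D' → f D ≢ f D'

module Submission where

-- Call a chord of the polygon *marked* if exactly one of its two ends
-- has colour 0, and 2-colour a triangulation D by the parity of the number
-- of marked diagonals of D.  A flip removes a diagonal (i , j) and inserts
-- a diagonal (k , l); the two cross, so i , j , k , l span a quadrilateral
-- whose four sides are polygon sides or diagonals common to both
-- triangulations.  When both triangulations are compatible, all six
-- segments among i , j , k , l join differently coloured vertices, so the
-- four colours are the four elements of V and exactly one of them is 0.
-- Hence exactly one of (i , j), (k , l) is marked and the flip changes the
-- parity.

open import Defs
open import Data.Nat using (ℕ; zero; suc; _≤_; _<_; _+_; _∸_; s≤s)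
open import Data.Nat.Properties
  using (_≟_; _≤?_; _<?_; <-irrefl; <-trans; ≤-trans; <-≤-trans; ≤-<-trans;
         ≰⇒>; ≮⇒≥; ≤∧≢⇒<; +-identityʳ; +-suc; m≤m+n)
open import Data.Fin using (Fin; zero; suc; toℕ; punchIn) renaming (_≟_ to _≟F_)
open import Data.Fin.Properties using (toℕ<n; punchInᵢ≢i; all?)
open import Data.Bool using (Bool; true; false; _xor_; _∧_; if_then_else_)
open import Data.Bool.Properties using (xor-∧-commutativeRing; xor-identityʳ; xor-same)
  renaming (_≟_ to _≟B_)
open import Data.Product using (_×_; _,_; proj₁; proj₂)
open import Data.Sum using (_⊎_; inj₁; inj₂)
open import Data.Empty using (⊥-elim)
open import Function using (flip; _∘′_)
open import Relation.Nullary using (¬_; Dec; yes; no; does)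
open import Relation.Nullary.Decidable using (_×-dec_; _→-dec_; ¬?; toWitness; dec-true; dec-false)
open import Relation.Binary.PropositionalEquality
  using (_≡_; _≢_; refl; sym; trans; cong; cong₂; ≢-sym; module ≡-Reasoning)
open import Algebra.Bundles using (CommutativeRing)
open import Algebra.Properties.CommutativeMonoid.Sum
  (CommutativeRing.+-commutativeMonoid xor-∧-commutativeRing)
  using (sum; sum-remove; sum-cong-≗; sum-replicate-zero; ∑-distrib-+)

open ≡-Reasoning

parity-zero : ∀ {n} (t : Fin n → Bool) → (∀ y → t y ≡ false) → sum t ≡ false
parity-zero {n} t off = trans (sum-cong-≗ off) (sum-replicate-zero n)

parity-point : ∀ {n} (t : Fin n → Bool) (x : Fin n) →
  (∀ y → y ≢ x → t y ≡ false) → sum t ≡ t x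
parity-point {suc n} t x off = begin
  sum t                         ≡⟨ sum-remove {i = x} t ⟩
  t x xor sum (t ∘′ punchIn x)  ≡⟨ cong (t x xor_) (parity-zero _ λ y → off _ (punchInᵢ≢i x y)) ⟩
  t x xor false                 ≡⟨ xor-identityʳ (t x) ⟩
  t x                           ∎

parity₂ : ∀ {n} → (Fin n → Fin n → Bool) → Bool
parity₂ t = sum (λ a → sum (t a))

parity₂-cong : ∀ {n} (s t : Fin n → Fin n → Bool) →
  (∀ a b → s a b ≡ t a b) → parity₂ s ≡ parity₂ t
parity₂-cong s t eq = sum-cong-≗ (λ a → sum-cong-≗ (eq a))

parity₂-xor : ∀ {n} (s t : Fin n → Fin n → Bool) →
  parity₂ (λ a b → s a b xor t a b) ≡ parity₂ s xor parity₂ t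
parity₂-xor s t = trans (sum-cong-≗ (λ a → ∑-distrib-+ (s a) (t a)))
                        (∑-distrib-+ (λ a → sum (s a)) (λ a → sum (t a)))

parity₂-point : ∀ {n} (t : Fin n → Fin n → Bool) (x y : Fin n) →
  (∀ a b → ¬ (a ≡ x × b ≡ y) → t a b ≡ false) → parity₂ t ≡ t x y
parity₂-point t x y off = begin
  parity₂ t    ≡⟨ parity-point _ x (λ a a≢x → parity-zero (t a) λ b → off a b (a≢x ∘′ proj₁)) ⟩
  sum (t x)    ≡⟨ parity-point (t x) y (λ b b≢y → off x b (b≢y ∘′ proj₂)) ⟩
  t x y        ∎

ifSplit : ∀ c v → v ≡ (if c then v else false) xor (if c then false else v)
ifSplit true  v = sym (xor-identityʳ v)
ifSplit false v = refl

parity₂-twoPoints : ∀ {n} (t : Fin n → Fin n → Bool) (x y x′ y′ : Fin n) →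
  ¬ (x′ ≡ x × y′ ≡ y) →
  (∀ a b → ¬ (a ≡ x × b ≡ y) → ¬ (a ≡ x′ × b ≡ y′) → t a b ≡ false) →
  parity₂ t ≡ t x y xor t x′ y′
parity₂-twoPoints {n} t x y x′ y′ distinct off = begin
  parity₂ t                            ≡⟨ parity₂-cong t _ split ⟩
  parity₂ (λ a b → at a b xor rest a b) ≡⟨ parity₂-xor at rest ⟩
  parity₂ at xor parity₂ rest          ≡⟨ cong₂ _xor_ (parity₂-point at x y at-off)
                                                       (parity₂-point rest x′ y′ rest-off) ⟩
  at x y xor rest x′ y′                ≡⟨ cong₂ _xor_ at-xy rest-x′y′ ⟩
  t x y xor t x′ y′                    ∎
  where
  at? : ∀ a b → Dec (a ≡ x × b ≡ y)
  at? a b = (a ≟F x) ×-dec (b ≟F y)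

  at rest : Fin n → Fin n → Bool
  at   a b = if does (at? a b) then t a b else false
  rest a b = if does (at? a b) then false else t a b

  split : ∀ a b → t a b ≡ at a b xor rest a b
  split a b = ifSplit (does (at? a b)) (t a b)

  at-off : ∀ a b → ¬ (a ≡ x × b ≡ y) → at a b ≡ false
  at-off a b ¬xy = cong (if_then t a b else false) (dec-false (at? a b) ¬xy)

  rest-off : ∀ a b → ¬ (a ≡ x′ × b ≡ y′) → rest a b ≡ false
  rest-off a b ¬x′y′ with at? a b
  ... | yes xy  = cong (if_then false else t a b) (dec-true (at? a b) xy)
  ... | no  ¬xy = trans (cong (if_then false else t a b) (dec-false (at? a b) ¬xy)) (off a b ¬xy ¬x′y′)

  at-xy : at x y ≡ t x y
  at-xy = cong (if_then t x y else false) (dec-true (at? x y) (refl , refl))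

  rest-x′y′ : rest x′ y′ ≡ t x′ y′
  rest-x′y′ = cong (if_then false else t x′ y′) (dec-false (at? x′ y′) distinct)

xor-true⇒≢ : ∀ {x y} → x xor y ≡ true → x ≢ y
xor-true⇒≢ {x} x⊕x≡true refl with trans (sym (xor-same x)) x⊕x≡true
... | ()

isZero : V → Bool
isZero zero    = true
isZero (suc _) = false

AllDistinct : {A : Set} → A → A → A → A → Set
AllDistinct a b c d = a ≢ b × a ≢ c × a ≢ d × b ≢ c × b ≢ d × c ≢ d

-- Four pairwise distinct colours exhaust V = Fin 4, so exactly one of them
-- is 0; checked by evaluating the decision procedure on all 4⁴ quadruples.
exactlyOneZero : ∀ a b c d → AllDistinct a b c d →
  (isZero a xor isZero b) xor (isZero c xor isZero d) ≡ true
exactlyOneZero = toWitness {a? = all? λ a → all? λ b → all? λ c → all? λ d →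
  (¬? (a ≟F b) ×-dec ¬? (a ≟F c) ×-dec ¬? (a ≟F d) ×-dec
   ¬? (b ≟F c) ×-dec ¬? (b ≟F d) ×-dec ¬? (c ≟F d)) →-dec (_ ≟B true)} _

marked : ∀ {n} → (Fin n → V) → Fin n → Fin n → Bool
marked col a b = isZero (col a) xor isZero (col b)

markedParity : ∀ {n} → (Fin n → V) → DiagSet n → Bool
markedParity col D = parity₂ (λ a b → D a b ∧ marked col a b)

-- (3) Chords with ends a < b and c < d on a line cross iff their ends
-- interleave; `Crosses` of Defs is this relation on the positions toℕ.

Cross : ℕ → ℕ → ℕ → ℕ → Set
Cross a b c d = ((a < c) × (c < b) × (b < d)) ⊎ ((c < a) × (a < d) × (d < b))

noCross-sameStart : ∀ {a b c} → ¬ Cross a b a c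
noCross-sameStart (inj₁ (a<a , _)) = <-irrefl refl a<a
noCross-sameStart (inj₂ (a<a , _)) = <-irrefl refl a<a

noCross-sameEnd : ∀ {a b c} → ¬ Cross a b c b
noCross-sameEnd (inj₁ (_ , _ , b<b)) = <-irrefl refl b<b
noCross-sameEnd (inj₂ (_ , _ , b<b)) = <-irrefl refl b<b

noCross-endStart : ∀ {a b c} → ¬ Cross a b b c
noCross-endStart (inj₁ (_ , b<b , _))       = <-irrefl refl b<b
noCross-endStart (inj₂ (b<a , a<c , c<b)) = <-irrefl refl (<-trans b<a (<-trans a<c c<b))

noCross-startEnd : ∀ {a b c} → ¬ Cross a b c a
noCross-startEnd (inj₁ (a<c , c<b , b<a)) = <-irrefl refl (<-trans a<c (<-trans c<b b<a))
noCross-startEnd (inj₂ (_ , a<a , _))       = <-irrefl refl a<a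

-- For a quadrilateral x₁ < x₂ < x₃ < x₄, a chord crossing one of its sides
-- crosses one of its diagonals (x₁ , x₃), (x₂ , x₄).
module Quadrilateral {x₁ x₂ x₃ x₄ : ℕ} (x₁<x₂ : x₁ < x₂) (x₂<x₃ : x₂ < x₃) (x₃<x₄ : x₃ < x₄) where

  SideOf : ℕ → ℕ → Set
  SideOf a b = ∀ p q → ¬ Cross x₁ x₃ p q → ¬ Cross x₂ x₄ p q → ¬ Cross a b p q

  side₁₂ : SideOf x₁ x₂
  side₁₂ p q ¬₁₃ ¬₂₄ (inj₁ (x₁<p , p<x₂ , x₂<q)) with q ≤? x₃
  ... | yes q≤x₃ = ¬₂₄ (inj₂ (p<x₂ , x₂<q , ≤-<-trans q≤x₃ x₃<x₄))
  ... | no  q≰x₃ = ¬₁₃ (inj₁ (x₁<p , <-trans p<x₂ x₂<x₃ , ≰⇒> q≰x₃))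
  side₁₂ p q ¬₁₃ ¬₂₄ (inj₂ (p<x₁ , x₁<q , q<x₂)) = ¬₁₃ (inj₂ (p<x₁ , x₁<q , <-trans q<x₂ x₂<x₃))

  side₂₃ : SideOf x₂ x₃
  side₂₃ p q ¬₁₃ ¬₂₄ (inj₁ (x₂<p , p<x₃ , x₃<q)) = ¬₁₃ (inj₁ (<-trans x₁<x₂ x₂<p , p<x₃ , x₃<q))
  side₂₃ p q ¬₁₃ ¬₂₄ (inj₂ (p<x₂ , x₂<q , q<x₃)) = ¬₂₄ (inj₂ (p<x₂ , x₂<q , <-trans q<x₃ x₃<x₄))

  side₃₄ : SideOf x₃ x₄
  side₃₄ p q ¬₁₃ ¬₂₄ (inj₁ (x₃<p , p<x₄ , x₄<q)) = ¬₂₄ (inj₁ (<-trans x₂<x₃ x₃<p , p<x₄ , x₄<q))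
  side₃₄ p q ¬₁₃ ¬₂₄ (inj₂ (p<x₃ , x₃<q , q<x₄)) with p <? x₂
  ... | yes p<x₂ = ¬₂₄ (inj₂ (p<x₂ , <-trans x₂<x₃ x₃<q , q<x₄))
  ... | no  p≮x₂ = ¬₁₃ (inj₁ (<-≤-trans x₁<x₂ (≮⇒≥ p≮x₂) , p<x₃ , x₃<q))

  side₁₄ : SideOf x₁ x₄
  side₁₄ p q ¬₁₃ ¬₂₄ (inj₁ (x₁<p , p<x₄ , x₄<q)) with p <? x₃
  ... | yes p<x₃ = ¬₁₃ (inj₁ (x₁<p , p<x₃ , <-trans x₃<x₄ x₄<q))
  ... | no  p≮x₃ = ¬₂₄ (inj₁ (<-≤-trans x₂<x₃ (≮⇒≥ p≮x₃) , p<x₄ , x₄<q))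
  side₁₄ p q ¬₁₃ ¬₂₄ (inj₂ (p<x₁ , x₁<q , q<x₄)) with q <? x₃
  ... | yes q<x₃ = ¬₁₃ (inj₂ (p<x₁ , x₁<q , q<x₃))
  ... | no  q≮x₃ = ¬₂₄ (inj₂ (<-trans p<x₁ x₁<x₂ , <-≤-trans x₂<x₃ (≮⇒≥ q≮x₃) , q<x₄))

nonAdjacent⇒diagonal : (n a b : ℕ) → a < b → b < n → b ≢ suc a → ¬ (a ≡ 0 × b ≡ n ∸ 1) →
  (suc (suc a) ≤ b) × (suc (suc b) ≤ n + a)
nonAdjacent⇒diagonal n zero b a<b b<n b≢1 ¬ends rewrite +-identityʳ n =
  ≤∧≢⇒< a<b (≢-sym b≢1) , ≤∧≢⇒< b<n (λ 1+b≡n → ¬ends (refl , cong (_∸ 1) 1+b≡n))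
nonAdjacent⇒diagonal n (suc a) b a<b b<n b≢2+a _ rewrite +-suc n a =
  ≤∧≢⇒< a<b (≢-sym b≢2+a) , s≤s (≤-trans b<n (m≤m+n n a))

Uncrossed : ∀ {n} → DiagSet n → Fin n → Fin n → Set
Uncrossed D a b = ∀ p q → D p q ≡ true → ¬ Crosses a b p q

-- In a compatible triangulation, a chord crossed by no diagonal is a polygon
-- side or (by maximality) a diagonal, so its ends have different colours.
uncrossed⇒differentColours : ∀ n (col : Fin n → V) → ProperColoring n col →
  (D : DiagSet n) → IsColorGraphVertex n col D →
  (a b : Fin n) → toℕ a < toℕ b → Uncrossed D a b → col a ≢ col b
uncrossed⇒differentColours n col (properSide , properClosing) D ((_ , _ , maximal) , compatible) a b a<b uncrossed
  with toℕ b ≟ suc (toℕ a) | (toℕ a ≟ 0) ×-dec (toℕ b ≟ n ∸ 1)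
... | yes adjacent | _ = properSide a b adjacent
... | no _ | yes (a≡0 , b≡n-1) = properClosing a b a≡0 b≡n-1
... | no notAdjacent | no notClosing with D a b in Dab
...   | true  = compatible a b Dab
...   | false with maximal a b (nonAdjacent⇒diagonal n (toℕ a) (toℕ b) a<b (toℕ<n b) notAdjacent notClosing) Dab
...     | p , q , Dpq , crosses = ⊥-elim (uncrossed p q Dpq crosses)

module FlipQuadrilateral (n : ℕ) (col : Fin n → V) (proper : ProperColoring n col)
  (D D′ : DiagSet n) (vD : IsColorGraphVertex n col D) (vD′ : IsColorGraphVertex n col D′)
  (i j k l : Fin n) (Dij : D i j ≡ true) (D′ij : D′ i j ≡ false)
  (Dkl : D k l ≡ false) (D′kl : D′ k l ≡ true)
  (agree : ∀ a b → ¬ (a ≡ i × b ≡ j) → ¬ (a ≡ k × b ≡ l) → D a b ≡ D′ a b) where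

  nonCrossing : ∀ a b p q → D a b ≡ true → D p q ≡ true → ¬ Crosses a b p q
  nonCrossing = proj₁ (proj₂ (proj₁ vD))

  nonCrossing′ : ∀ a b p q → D′ a b ≡ true → D′ p q ≡ true → ¬ Crosses a b p q
  nonCrossing′ = proj₁ (proj₂ (proj₁ vD′))

  -- The removed diagonal crosses the inserted one: D′ is maximal, and the
  -- only diagonal of D′ that is not in D is (k , l).
  removed-crosses-inserted : Crosses i j k l
  removed-crosses-inserted
    with proj₂ (proj₂ (proj₁ vD′)) i j (proj₁ (proj₁ vD) i j Dij) D′ij
  ... | p , q , D′pq , crosses with (p ≟F k) ×-dec (q ≟F l)
  ...   | yes (refl , refl) = crosses
  ...   | no ¬kl = ⊥-elim (nonCrossing i j p q Dij (trans (agree p q ¬ij ¬kl) D′pq) crosses)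
    where
    ¬ij : ¬ (p ≡ i × q ≡ j)
    ¬ij (refl , refl) with trans (sym D′pq) D′ij
    ... | ()

  -- A side of the quadrilateral (it meets (i , j) in an end, and crosses
  -- (i , j) or (k , l) whenever some chord crosses it) is uncrossed in D:
  -- every other diagonal of D also lies in D′ and so crosses neither.
  side-uncrossed : (a b : Fin n) →
    (∀ p q → ¬ Cross (toℕ i) (toℕ j) p q → ¬ Cross (toℕ k) (toℕ l) p q → ¬ Cross (toℕ a) (toℕ b) p q) →
    ¬ Crosses a b i j → Uncrossed D a b
  side-uncrossed a b side ¬crosses-ij p q Dpq with (p ≟F i) ×-dec (q ≟F j)
  ... | yes (refl , refl) = ¬crosses-ij
  ... | no ¬ij with (p ≟F k) ×-dec (q ≟F l)
  ...   | yes (refl , refl) with trans (sym Dpq) Dkl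
  ...     | ()
  side-uncrossed a b side ¬crosses-ij p q Dpq | no ¬ij | no ¬kl =
    side (toℕ p) (toℕ q) (nonCrossing i j p q Dij Dpq)
      (nonCrossing′ k l p q D′kl (trans (sym (agree p q ¬ij ¬kl)) Dpq))

  differentColours : (a b : Fin n) → toℕ a < toℕ b → Uncrossed D a b → col a ≢ col b
  differentColours = uncrossed⇒differentColours n col proper D vD

  -- The four corners of the quadrilateral carry four distinct colours: its
  -- diagonals are compatible and its sides are uncrossed.
  corners-distinct : AllDistinct (col i) (col j) (col k) (col l)
  corners-distinct with removed-crosses-inserted
  ... | inj₁ (i<k , k<j , j<l) =
    proj₂ vD i j Dij , c-ik , c-il , ≢-sym c-kj , c-jl , proj₂ vD′ k l D′kl
    where
    open Quadrilateral i<k k<j j<l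
    c-ik : col i ≢ col k
    c-kj : col k ≢ col j
    c-jl : col j ≢ col l
    c-il : col i ≢ col l
    c-ik = differentColours i k i<k (side-uncrossed i k side₁₂ noCross-sameStart)
    c-kj = differentColours k j k<j (side-uncrossed k j side₂₃ noCross-sameEnd)
    c-jl = differentColours j l j<l (side-uncrossed j l side₃₄ noCross-startEnd)
    c-il = differentColours i l (<-trans i<k (<-trans k<j j<l)) (side-uncrossed i l side₁₄ noCross-sameStart)
  ... | inj₂ (k<i , i<l , l<j) =
    proj₂ vD i j Dij , ≢-sym c-ki , c-il , ≢-sym c-kj , ≢-sym c-lj , proj₂ vD′ k l D′kl
    where
    open Quadrilateral k<i i<l l<j
    c-ki : col k ≢ col i
    c-il : col i ≢ col l
    c-lj : col l ≢ col j
    c-kj : col k ≢ col j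
    c-ki = differentColours k i k<i (side-uncrossed k i (λ p q → flip (side₁₂ p q)) noCross-endStart)
    c-il = differentColours i l i<l (side-uncrossed i l (λ p q → flip (side₂₃ p q)) noCross-sameStart)
    c-lj = differentColours l j l<j (side-uncrossed l j (λ p q → flip (side₃₄ p q)) noCross-sameEnd)
    c-kj = differentColours k j (<-trans k<i (<-trans i<l l<j)) (side-uncrossed k j (λ p q → flip (side₁₄ p q)) noCross-sameEnd)

  oneFlippedMarked : marked col i j xor marked col k l ≡ true
  oneFlippedMarked with corners-distinct
  ... | dij , dik , dil , djk , djl , dkl =
    exactlyOneZero (col i) (col j) (col k) (col l) (dij , dik , dil , djk , djl , dkl)

  -- The marked parities of D and D′ differ: their marked diagonals differ
  -- exactly at (i , j) and (k , l).
  flip-changes-parity : markedParity col D xor markedParity col D′ ≡ true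
  flip-changes-parity = begin
    parity₂ g xor parity₂ g′                 ≡⟨ parity₂-xor g g′ ⟨
    parity₂ (λ a b → g a b xor g′ a b)       ≡⟨ parity₂-twoPoints _ i j k l kl≢ij unchanged ⟩
    (g i j xor g′ i j) xor (g k l xor g′ k l) ≡⟨ cong₂ _xor_ removed inserted ⟩
    marked col i j xor marked col k l         ≡⟨ oneFlippedMarked ⟩
    true                                      ∎
    where
    g g′ : Fin n → Fin n → Bool
    g  a b = D  a b ∧ marked col a b
    g′ a b = D′ a b ∧ marked col a b

    kl≢ij : ¬ (k ≡ i × l ≡ j)
    kl≢ij (refl , refl) with trans (sym Dij) Dkl
    ... | ()

    unchanged : ∀ a b → ¬ (a ≡ i × b ≡ j) → ¬ (a ≡ k × b ≡ l) → g a b xor g′ a b ≡ false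
    unchanged a b ¬ij ¬kl rewrite agree a b ¬ij ¬kl = xor-same (g′ a b)

    removed : g i j xor g′ i j ≡ marked col i j
    removed rewrite Dij | D′ij = xor-identityʳ (marked col i j)

    inserted : g k l xor g′ k l ≡ marked col k l
    inserted rewrite Dkl | D′kl = refl

corollary1 : (n : ℕ) → 3 ≤ n → (col : Fin n → V) → ProperColoring n col →
    ColorGraphBipartite n col
corollary1 n _ col proper = markedParity col , separates
  where
  separates : ∀ D D′ → IsColorGraphVertex n col D → IsColorGraphVertex n col D′ →
    Flip n D D′ → markedParity col D ≢ markedParity col D′
  separates D D′ vD vD′ (i , j , k , l , Dij , D′ij , Dkl , D′kl , agree) =
    xor-true⇒≢ flip-changes-parity
    where open FlipQuadrilateral n col proper D D′ vD vD′ i j k l Dij D′ij Dkl D′kl agree
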